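{- For $p\geq 2d$, we have \[ N_{\mathrm{trop}}(p,d) \geq (p-2d+7) (2^{d-2}-2) \enspace . \]
   Context: A sign pattern is a $p\times d$ array $(\epsilon_{ij})$ of signs $+$ or $-$. Positions $(i,j)$, $1\le i\le p$, $1\le j\le d$, are viewed as entries of a $p\times d$ matrix ($(1,1)$ top left). An oriented lattice path is a sequence of positions starting at some top node $(1,j)$ and ending at some bottom node $(p,j')$, each step going either one position down or one position to the right; it thus consists of vertical segments and horizontal segments. Such a path is tropically allowed for $(\epsilon_{ij})$ if: (i) every sign on the initial vertical segment, except possibly the bottom one, is $+$; (ii) every sign on the final vertical segment, except possibly the top one, is $+$; (iii) every sign on any other vertical segment, except possibly its top and bottom signs, is $+$; (iv) for every horizontal segment, the pair (sign of leftmost position, sign of rightmost position) is $(+,-)$ or $(-,+)$; (v) once a pair $(-,+)$ occurs for some horizontal segment, the pairs of all horizontal segments below it are also $(-,+)$. $N_{\mathrm{trop}}(p,d)$ denotes the maximal number, over all $p\times d$ sign patterns, of tropically allowed lattice paths. -}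

module Defs where

open import Data.Bool using (Bool; true; false; _∧_; _∨_; not; _xor_)
open import Data.Nat using (ℕ; zero; suc; _⊔_; _≡ᵇ_; _≤ᵇ_; _<ᵇ_)
open import Data.Fin using (Fin; toℕ; inject₁; fromℕ)
open import Data.List using (List; []; _∷_; [_]; map; concatMap; filter; length; foldr)
open import Data.Vec using (Vec; lookup) renaming ([] to []ᵥ; _∷_ to _∷ᵥ_)
open import Data.List using (allFin)
open import Relation.Nullary.Decidable using (Dec)
open import Data.Bool.Properties using (T?)

-- Signs: true = '+', false = '-'.
-- A p × d sign pattern: p rows, each a vector of d signs.
-- Rows and columns are 0-indexed (row 0 = top row, column 0 = leftmost).
SignPattern : ℕ → ℕ → Set
SignPattern p d = Vec (Vec Bool d) p

sign : ∀ {p d} → SignPattern p d → Fin p → Fin d → Bool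
sign σ i c = lookup (lookup σ i) c

-- An oriented lattice path from a top node to a bottom node of a p × d grid
-- meets every row in a contiguous horizontal block; it is determined by the
-- vector  cols = (c₀ , c₁ , … , c_p)  of columns, where row i (0 ≤ i < p)
-- is occupied exactly on the columns  c_i , … , c_{i+1}  (c₀ = starting column
-- in the top row, c_p = final column in the bottom row), and
-- c₀ ≤ c₁ ≤ … ≤ c_p.  Conversely every such non-decreasing vector gives a
-- unique path.
all : ∀ {A : Set} → (A → Bool) → List A → Bool
all f [] = true
all f (x ∷ xs) = f x ∧ all f xs

PathCode : ℕ → ℕ → Set
PathCode p d = Vec (Fin d) (suc p)

module _ {p d : ℕ} (σ : SignPattern p d) (cols : PathCode p d) where

  rows : List (Fin p)
  rows = allFin p

  columns : List (Fin d)
  columns = allFin d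

  left right : Fin p → Fin d
  left  i = lookup cols (inject₁ i)
  right i = lookup cols (Data.Fin.suc i)

  startCol endCol : Fin d
  startCol = lookup cols Data.Fin.zero
  endCol   = lookup cols (fromℕ p)

  _==_ : Fin d → Fin d → Bool
  a == b = toℕ a ≡ᵇ toℕ b

  _⇒_ : Bool → Bool → Bool
  a ⇒ b = not a ∨ b

  isPath : Bool
  isPath = all (λ i → toℕ (left i) ≤ᵇ toℕ (right i)) rows

  onPath : Fin p → Fin d → Bool
  onPath i c = (toℕ (left i) ≤ᵇ toℕ c) ∧ (toℕ c ≤ᵇ toℕ (right i))

  -- The vertical segment in column c consists of all path positions in
  -- column c (a contiguous set of rows).  (i , c) is the top of that
  -- segment iff the position just above is not on the path, and the bottom
  -- iff the position just below is not on the path.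
  isTop : Fin p → Fin d → Bool
  isTop i c = (toℕ i ≡ᵇ 0) ∨ not (c == left i)

  isBottom : Fin p → Fin d → Bool
  isBottom i c = (suc (toℕ i) ≡ᵇ p) ∨ not (c == right i)

  initialSeg finalSeg : Fin d → Bool
  initialSeg c = c == startCol
  finalSeg   c = c == endCol

  -- conditions (i), (ii), (iii): a path position (i , c) may carry '-' only
  -- if it is exempted by every one of the conditions that apply to the
  -- vertical segment containing it.
  exempt : Fin p → Fin d → Bool
  exempt i c =
    (initialSeg c ⇒ isBottom i c)
    ∧ (finalSeg c ⇒ isTop i c)
    ∧ ((not (initialSeg c) ∧ not (finalSeg c)) ⇒ (isTop i c ∨ isBottom i c))

  verticalOK : Bool
  verticalOK = all (λ i → all (λ c → onPath i c ⇒ (sign σ i c ∨ exempt i c)) columns) rows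

  horizontal : Fin p → Bool
  horizontal i = toℕ (left i) <ᵇ toℕ (right i)

  minusPlus : Fin p → Bool
  minusPlus i = not (sign σ i (left i)) ∧ sign σ i (right i)

  horizontalOK : Bool
  horizontalOK = all (λ i → horizontal i ⇒ (sign σ i (left i) xor sign σ i (right i))) rows

  orderOK : Bool
  orderOK = all (λ i → all (λ k →
              ((toℕ i <ᵇ toℕ k) ∧ horizontal i ∧ horizontal k ∧ minusPlus i) ⇒ minusPlus k)
              rows) rows

  tropicallyAllowed : Bool
  tropicallyAllowed = isPath ∧ verticalOK ∧ horizontalOK ∧ orderOK

allVecs : ∀ {A : Set} → List A → (n : ℕ) → List (Vec A n)
allVecs xs zero = [ []ᵥ ]
allVecs xs (suc n) = concatMap (λ x → map (x ∷ᵥ_) (allVecs xs n)) xs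

allPatterns : (p d : ℕ) → List (SignPattern p d)
allPatterns p d = allVecs (allVecs (true ∷ false ∷ []) d) p

numAllowed : ∀ {p d} → SignPattern p d → ℕ
numAllowed {p} {d} σ =
  length (filter (λ cols → T? (tropicallyAllowed σ cols)) (allVecs (allFin d) (suc p)))

Ntrop : ℕ → ℕ → ℕ
Ntrop p d = foldr _⊔_ 0 (map numAllowed (allPatterns p d))

module Submission where

-- We only count paths of a special shape: in every row the path either runs straight down
-- through a '+' or makes one horizontal move between positions of opposite signs, and no
-- (+,−) move follows a (−,+) move.  Such paths are tropically allowed, and they are counted
-- row by row by a transfer-matrix recursion whose state is the current column together with a
-- flag recording whether a (−,+) move has occurred.
--
-- For d = e + 4 the pattern consists, from the top, of rows with a single '−' in columns
-- 1, …, e+1, then B = p − 2d + 7 rows with '−' in columns 1 and e+2, then rows with a single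
-- '−' in columns 2, …, e+1.  A staircase of holes doubles counts: an unflagged walk left of a
-- hole may go down or step into it, and a flagged walk in a hole may step to any column on its
-- right.  Below the upper staircase about B·2^(e+1) walks start in column 0 (each middle row
-- offers a step to column 1, from where a flagged walk runs through the lower staircase), about
-- 2^(e+1) in column 1, and at least B in each of the columns 2, …, e+1 (stepping into column
-- e+2); the upper staircase then adds about B·2^(e+1) more, for B·2^(d−2) − 2B in all.

open import Defs
open import Data.Nat using (ℕ; _+_; _*_; _∸_; _^_; _≤_)

open import Data.Bool using (Bool; true; false; not; _∧_; _∨_; _xor_; if_then_else_; T)
open import Data.Bool.Properties using (T-≡; T?; ∨-zeroʳ)
open import Data.Empty using (⊥-elim)
open import Data.Fin as F using (Fin; toℕ; inject₁; fromℕ)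
open import Data.Fin.Properties using (toℕ-injective)
open import Data.List using (List; []; _∷_; [_]; _++_; map; replicate; concatMap; length; filter; foldr; tabulate; allFin)
open import Data.List.Properties using (length-++; length-replicate; length-map; map-cong; map-tabulate; filter-all)
open import Data.List.Membership.Propositional using (_∈_)
open import Data.List.Membership.Propositional.Properties using (∈-map⁺; ∈-concatMap⁺; ∈-allFin)
open import Data.List.Relation.Unary.All as All using (All; []; _∷_)
import Data.List.Relation.Unary.All.Properties as All
open import Data.List.Relation.Unary.Any as Any using (here; there)
open import Data.List.Relation.Binary.Sublist.Propositional using (_⊆_; []; ⊆-refl; ⊆-trans; minimum)
open import Data.List.Relation.Binary.Sublist.Propositional.Properties using (++⁺; ++⁺ˡ; ++⁺ʳ; map⁺; filter⁺; length-mono-≤)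
open import Data.Maybe using (Maybe; just; nothing; maybe′)
open import Data.Nat using (zero; suc; _⊔_; _<_; _≡ᵇ_; _<ᵇ_; _≤ᵇ_; z≤n; s≤s; z<s; s<s)
open import Data.Nat.ListAction using (sum)
open import Data.Nat.Properties
open import Data.Nat.Tactic.RingSolver using (solve-∀)
open import Data.Product using (_×_; _,_)
open import Data.Sum using (_⊎_; inj₁; inj₂)
open import Data.Vec as V using (Vec; lookup)
open import Data.Vec.Properties using (lookup∘tabulate)
open import Function using (Equivalence; _∘_; id; case_of_)
open import Relation.Binary.Definitions using (tri<; tri≈; tri>)
open import Relation.Binary.PropositionalEquality hiding ([_])
open import Relation.Nullary using (yes; no)
open import Relation.Nullary.Decidable using (dec-true; dec-false)

true⇒T : ∀ {b} → b ≡ true → T b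
true⇒T = Equivalence.from T-≡

∧-true⁺ : ∀ {a b} → a ≡ true → b ≡ true → (a ∧ b) ≡ true
∧-true⁺ refl refl = refl

∧-true⁻ : ∀ {a b} → (a ∧ b) ≡ true → a ≡ true × b ≡ true
∧-true⁻ {true} {true} _ = refl , refl

⇒-true : ∀ {a b} → (a ≡ true → b ≡ true) → (not a ∨ b) ≡ true
⇒-true {false} _ = refl
⇒-true {true}  h = h refl

all-true : ∀ {A : Set} (f : A → Bool) (xs : List A) → (∀ x → f x ≡ true) → all f xs ≡ true
all-true f []       h = refl
all-true f (x ∷ xs) h = ∧-true⁺ (h x) (all-true f xs h)

≤ᵇ-true⁺ : ∀ {m n} → m ≤ n → (m ≤ᵇ n) ≡ true
≤ᵇ-true⁺ h = Equivalence.to T-≡ (≤⇒≤ᵇ h)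

≤ᵇ-true⁻ : ∀ {m n} → (m ≤ᵇ n) ≡ true → m ≤ n
≤ᵇ-true⁻ {m} {n} h = ≤ᵇ⇒≤ m n (true⇒T h)

≡ᵇ-false : ∀ {m n} → m ≢ n → (m ≡ᵇ n) ≡ false
≡ᵇ-false {m} {n} = dec-false (m ≟ n)

≡ᵇ-true : ∀ {m n} → m ≡ n → (m ≡ᵇ n) ≡ true
≡ᵇ-true {m} {n} = dec-true (m ≟ n)

<ᵇ-true⁻ : ∀ {m n} → (m <ᵇ n) ≡ true → m < n
<ᵇ-true⁻ {m} {n} h = <ᵇ⇒< m n (true⇒T h)

∑< : ℕ → (ℕ → ℕ) → ℕ
∑< zero    h = 0
∑< (suc n) h = h 0 + ∑< n (h ∘ suc)

∑<-tabulate : ∀ n (h : ℕ → ℕ) → sum (tabulate (h ∘ toℕ {n})) ≡ ∑< n h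
∑<-tabulate zero    h = refl
∑<-tabulate (suc n) h = cong (h 0 +_) (∑<-tabulate n (h ∘ suc))

∑<-cong : ∀ n {g h : ℕ → ℕ} → (∀ i → g i ≡ h i) → ∑< n g ≡ ∑< n h
∑<-cong zero    g≡h = refl
∑<-cong (suc n) g≡h = cong₂ _+_ (g≡h 0) (∑<-cong n (g≡h ∘ suc))

∑<-mono : ∀ n {g h : ℕ → ℕ} → (∀ i → i < n → g i ≤ h i) → ∑< n g ≤ ∑< n h
∑<-mono zero    g≤h = z≤n
∑<-mono (suc n) g≤h = +-mono-≤ (g≤h 0 z<s) (∑<-mono n (λ i → g≤h (suc i) ∘ s<s))

∑<-split : ∀ m n (h : ℕ → ℕ) → ∑< (m + n) h ≡ ∑< m h + ∑< n (h ∘ (m +_))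
∑<-split zero    n h = refl
∑<-split (suc m) n h = trans (cong (h 0 +_) (∑<-split m n (h ∘ suc))) (sym (+-assoc (h 0) _ _))

suffix≤∑< : ∀ m n (h : ℕ → ℕ) → ∑< n (h ∘ (m +_)) ≤ ∑< (m + n) h
suffix≤∑< m n h = ≤-trans (m≤n+m _ (∑< m h)) (≤-reflexive (sym (∑<-split m n h)))

n≤∑< : ∀ n {h : ℕ → ℕ} → (∀ i → i < n → 1 ≤ h i) → n ≤ ∑< n h
n≤∑< zero    _   = z≤n
n≤∑< (suc n) 1≤h = +-mono-≤ (1≤h 0 z<s) (n≤∑< n (λ i → 1≤h (suc i) ∘ s<s))

term≤∑< : ∀ {n} (h : ℕ → ℕ) {b} → b < n → h b ≤ ∑< n h
term≤∑< {suc n} h {zero}  _         = m≤m+n _ _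
term≤∑< {suc n} h {suc b} (s<s b<n) = ≤-trans (term≤∑< (h ∘ suc) b<n) (m≤n+m _ _)

prefix+term≤∑< : ∀ {k b n} (h : ℕ → ℕ) → k ≤ b → b < n → ∑< k h + h b ≤ ∑< n h
prefix+term≤∑< {zero}  h _ b<n = term≤∑< h b<n
prefix+term≤∑< {suc k} {suc b} {suc n} h (s≤s k≤b) (s<s b<n) =
  ≤-trans (≤-reflexive (+-assoc (h 0) _ _)) (+-monoʳ-≤ (h 0) (prefix+term≤∑< (h ∘ suc) k≤b b<n))

two≤∑< : ∀ {n} (h : ℕ → ℕ) {b₁ b₂} → b₁ < b₂ → b₂ < n → h b₁ + h b₂ ≤ ∑< n h
two≤∑< h b₁<b₂ b₂<n = ≤-trans (+-monoˡ-≤ _ (term≤∑< h (n<1+n _))) (prefix+term≤∑< h b₁<b₂ b₂<n)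

three≤∑< : ∀ {n} (h : ℕ → ℕ) {b₁ b₂ b₃} → b₁ < b₂ → b₂ < b₃ → b₃ < n → h b₁ + h b₂ + h b₃ ≤ ∑< n h
three≤∑< h b₁<b₂ b₂<b₃ b₃<n = ≤-trans (+-monoˡ-≤ _ (two≤∑< h b₁<b₂ (n<1+n _))) (prefix+term≤∑< h b₂<b₃ b₃<n)

length-concatMap : ∀ {A B : Set} (f : A → List B) xs → length (concatMap f xs) ≡ sum (map (length ∘ f) xs)
length-concatMap f []       = refl
length-concatMap f (x ∷ xs) = trans (length-++ (f x)) (cong (length (f x) +_) (length-concatMap f xs))

concatMap⁺ : ∀ {A B : Set} {f g : A → List B} xs → (∀ x → f x ⊆ g x) → concatMap f xs ⊆ concatMap g xs
concatMap⁺ []       _   = []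
concatMap⁺ (x ∷ xs) f⊆g = ++⁺ (f⊆g x) (concatMap⁺ xs f⊆g)

⊆-concatMap : ∀ {A B : Set} {f : A → List B} {x xs} → x ∈ xs → f x ⊆ concatMap f xs
⊆-concatMap {xs = _ ∷ xs} (here refl)  = ++⁺ʳ _ ⊆-refl
⊆-concatMap {f = f} {xs = y ∷ _} (there x∈xs) = ++⁺ˡ (f y) (⊆-concatMap x∈xs)

allVecs-complete : ∀ {A : Set} {xs : List A} → (∀ a → a ∈ xs) → ∀ n (v : Vec A n) → v ∈ allVecs xs n
allVecs-complete every zero    V.[]       = here refl
allVecs-complete every (suc n) (a V.∷ v) =
  ∈-concatMap⁺ _ (Any.map (λ { refl → ∈-map⁺ (a V.∷_) (allVecs-complete every n v) }) (every a))

f≤foldr-⊔ : ∀ {A : Set} (f : A → ℕ) {x xs} → x ∈ xs → f x ≤ foldr _⊔_ 0 (map f xs)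
f≤foldr-⊔ f (here refl) = m≤m⊔n _ _
f≤foldr-⊔ f (there x∈xs) = ≤-trans (f≤foldr-⊔ f x∈xs) (m≤n⊔m _ _)

numAllowed≤Ntrop : ∀ {p d} (σ : SignPattern p d) → numAllowed σ ≤ Ntrop p d
numAllowed≤Ntrop {p} {d} σ = f≤foldr-⊔ numAllowed (allVecs-complete (allVecs-complete bool d) p σ)
  where
  bool : ∀ b → b ∈ true ∷ false ∷ []
  bool true  = here refl
  bool false = there (here refl)

allowed-sublist≤numAllowed : ∀ {p d} (σ : SignPattern p d) {vs} → vs ⊆ allVecs (allFin d) (suc p)
                           → All (λ v → tropicallyAllowed σ v ≡ true) vs → length vs ≤ numAllowed σ
allowed-sublist≤numAllowed σ {vs} vs⊆ allowed = begin
  length vs                  ≡⟨ cong length (filter-all P? (All.map true⇒T allowed)) ⟨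
  length (filter P? vs)      ≤⟨ length-mono-≤ (filter⁺ P? P? (λ { refl → id }) vs⊆) ⟩
  numAllowed σ               ∎
  where
  open ≤-Reasoning
  P? = λ v → T? (tropicallyAllowed σ v)

-- A row-by-row sufficient condition for being tropically allowed

module _ {d : ℕ} where

  Increasing : ∀ {n} → Vec (Fin d) (suc n) → Set
  Increasing {n} v = ∀ (i : Fin n) → toℕ (lookup v (inject₁ i)) ≤ toℕ (lookup v (F.suc i))

  head≤lookup : ∀ {n} (v : Vec (Fin d) (suc n)) → Increasing v → ∀ j → toℕ (lookup v F.zero) ≤ toℕ (lookup v j)
  head≤lookup v inc F.zero = ≤-refl
  head≤lookup {suc n} (x V.∷ w) inc (F.suc j) = ≤-trans (inc F.zero) (head≤lookup w (inc ∘ F.suc) j)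

  lookup≤last : ∀ {n} (v : Vec (Fin d) (suc n)) → Increasing v → ∀ j → toℕ (lookup v j) ≤ toℕ (lookup v (fromℕ n))
  lookup≤last {zero} (x V.∷ V.[]) inc F.zero = ≤-refl
  lookup≤last {suc n} (x V.∷ w) inc F.zero = ≤-trans (inc F.zero) (lookup≤last w (inc ∘ F.suc) F.zero)
  lookup≤last {suc n} (x V.∷ w) inc (F.suc j) = lookup≤last w (inc ∘ F.suc) j

module _ {p d : ℕ} (σ : SignPattern p d) (v : PathCode p d) where

  RowwiseAllowed : Set
  RowwiseAllowed = ∀ i →
      (toℕ (left σ v i) ≡ toℕ (right σ v i) × sign σ i (left σ v i) ≡ true)
    ⊎ (toℕ (left σ v i) < toℕ (right σ v i) × (sign σ i (left σ v i) xor sign σ i (right σ v i)) ≡ true)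

  MinusPlusClosedBelow : Set
  MinusPlusClosedBelow = ∀ i k → toℕ i < toℕ k → horizontal σ v i ≡ true → horizontal σ v k ≡ true
                       → minusPlus σ v i ≡ true → minusPlus σ v k ≡ true

  rowwise⇒increasing : RowwiseAllowed → Increasing v
  rowwise⇒increasing ok i with ok i
  ... | inj₁ (l≡r , _) = ≤-reflexive l≡r
  ... | inj₂ (l<r , _) = <⇒≤ l<r

  exempt-bottom : ∀ i c → isBottom σ v i c ≡ true → finalSeg σ v c ≡ false → exempt σ v i c ≡ true
  exempt-bottom i c bot fin rewrite bot | fin with initialSeg σ v c | isTop σ v i c
  ... | true  | _     = refl
  ... | false | true  = refl
  ... | false | false = refl

  exempt-top : ∀ i c → isTop σ v i c ≡ true → initialSeg σ v c ≡ false → exempt σ v i c ≡ true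
  exempt-top i c top ini rewrite top | ini with finalSeg σ v c | isBottom σ v i c
  ... | true  | _     = refl
  ... | false | true  = refl
  ... | false | false = refl

  bottom-if-≢right : ∀ i c → toℕ c ≢ toℕ (right σ v i) → isBottom σ v i c ≡ true
  bottom-if-≢right i c c≢r rewrite ≡ᵇ-false c≢r = ∨-zeroʳ _

  top-if-≢left : ∀ i c → toℕ c ≢ toℕ (left σ v i) → isTop σ v i c ≡ true
  top-if-≢left i c c≢l rewrite ≡ᵇ-false c≢l = ∨-zeroʳ _

  -- A '−' at the left end of a horizontal segment is the bottom of a vertical segment that is
  -- not the final one; any other '−' on the path is the top of one that is not the initial one.
  minus⇒exempt : RowwiseAllowed → ∀ i c → onPath σ v i c ≡ true → sign σ i c ≡ false → exempt σ v i c ≡ true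
  minus⇒exempt ok i c on minus with ∧-true⁻ on | ok i
  ... | l≤c , c≤r | inj₁ (l≡r , plus) = case trans (sym plus) (subst (λ x → sign σ i x ≡ false) c≡l minus) of λ ()
    where
    c≡l : c ≡ left σ v i
    c≡l = toℕ-injective (≤-antisym (≤-trans (≤ᵇ-true⁻ c≤r) (≤-reflexive (sym l≡r))) (≤ᵇ-true⁻ l≤c))
  ... | l≤c , _ | inj₂ (l<r , _) with toℕ c ≟ toℕ (left σ v i)
  ...   | yes c≡l = exempt-bottom i c (bottom-if-≢right i c (<⇒≢ c<r)) (≡ᵇ-false (<⇒≢ (≤-trans c<r r≤end)))
    where
    c<r = subst (_< _) (sym c≡l) l<r
    r≤end = lookup≤last v (rowwise⇒increasing ok) (F.suc i)
  ...   | no  c≢l = exempt-top i c (top-if-≢left i c c≢l) (≡ᵇ-false (>⇒≢ (≤-trans (s≤s start≤l) l<c)))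
    where
    l<c = ≤∧≢⇒< (≤ᵇ-true⁻ l≤c) (c≢l ∘ sym)
    start≤l = head≤lookup v (rowwise⇒increasing ok) (inject₁ i)

  rowwise⇒allowed : RowwiseAllowed → MinusPlusClosedBelow → tropicallyAllowed σ v ≡ true
  rowwise⇒allowed ok closed = ∧-true⁺ pathOK (∧-true⁺ verticalOK′ (∧-true⁺ horizontalOK′ orderOK′))
    where
    pathOK : isPath σ v ≡ true
    pathOK = all-true _ (rows σ v) (≤ᵇ-true⁺ ∘ rowwise⇒increasing ok)

    plusOrExempt : ∀ i c → onPath σ v i c ≡ true → (sign σ i c ∨ exempt σ v i c) ≡ true
    plusOrExempt i c on with sign σ i c in eq
    ... | true  = refl
    ... | false = minus⇒exempt ok i c on eq

    verticalOK′ : verticalOK σ v ≡ true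
    verticalOK′ = all-true _ (rows σ v) λ i → all-true _ (columns σ v) λ c → ⇒-true (plusOrExempt i c)

    oppositeEnds : ∀ i → horizontal σ v i ≡ true → (sign σ i (left σ v i) xor sign σ i (right σ v i)) ≡ true
    oppositeEnds i hor with ok i
    ... | inj₁ (l≡r , _)     = ⊥-elim (<-irrefl l≡r (<ᵇ-true⁻ hor))
    ... | inj₂ (_ , opposite) = opposite

    horizontalOK′ : horizontalOK σ v ≡ true
    horizontalOK′ = all-true _ (rows σ v) λ i → ⇒-true (oppositeEnds i)

    orderOK′ : orderOK σ v ≡ true
    orderOK′ = all-true _ (rows σ v) λ i → all-true _ (rows σ v) λ k → ⇒-true λ h →
      let i<k , rest = ∧-true⁻ h ; hi , rest′ = ∧-true⁻ rest ; hk , mpi = ∧-true⁻ rest′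
      in closed i k (<ᵇ-true⁻ i<k) hi hk mpi

  AllMinusPlus : Set
  AllMinusPlus = ∀ k → horizontal σ v k ≡ true → minusPlus σ v k ≡ true

Row : Set
Row = ℕ → Bool

-- A walk crosses a row from column a to column b.  The flag records whether a (−,+) move has
-- already occurred; from then on (+,−) moves are barred, as required by condition (v).
data Step (ρ : Row) (a b : ℕ) : Bool → Bool → Set where
  stay           : ∀ {φ} → a ≡ b → ρ a ≡ true → Step ρ a b φ φ
  rightPlusMinus : a < b → ρ a ≡ true → ρ b ≡ false → Step ρ a b false false
  rightMinusPlus : ∀ {φ} → a < b → ρ a ≡ false → ρ b ≡ true → Step ρ a b φ true

horizontalStep : Bool → Bool → Bool → Maybe Bool
horizontalStep true  false false = just false
horizontalStep false true  _     = just true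
horizontalStep _     _     _     = nothing

step : Row → ℕ → ℕ → Bool → Maybe Bool
step ρ a b φ with <-cmp a b
... | tri< _ _ _ = horizontalStep (ρ a) (ρ b) φ
... | tri≈ _ _ _ = if ρ a then just φ else nothing
... | tri> _ _ _ = nothing

step-sound : ∀ {ρ a b φ φ′} → step ρ a b φ ≡ just φ′ → Step ρ a b φ φ′
step-sound {ρ} {a} {b} {φ} eq with <-cmp a b
... | tri≈ _ a≡b _ with ρ a in ρa | eq
...   | true  | refl = stay a≡b ρa
...   | false | ()
step-sound {ρ} {a} {b} {φ} eq | tri< a<b _ _ with ρ a in ρa | ρ b in ρb | φ | eq
... | true  | false | false | refl = rightPlusMinus a<b ρa ρb
... | false | true  | _     | refl = rightMinusPlus a<b ρa ρb
... | true  | true  | _     | ()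
... | true  | false | true  | ()
... | false | false | _     | ()
step-sound () | tri> _ _ _

step-complete : ∀ {ρ a b φ φ′} → Step ρ a b φ φ′ → step ρ a b φ ≡ just φ′
step-complete {ρ} {a} {b} s with <-cmp a b | s
... | tri< _ _ _     | rightPlusMinus _ ρa ρb rewrite ρa | ρb = refl
... | tri< _ _ _     | rightMinusPlus _ ρa ρb rewrite ρa | ρb = refl
... | tri< a<b _ _   | stay a≡b _ = ⊥-elim (<-irrefl a≡b a<b)
... | tri≈ _ _ _     | stay _ ρa rewrite ρa = refl
... | tri≈ _ a≡b _   | rightPlusMinus a<b _ _ = ⊥-elim (<-irrefl a≡b a<b)
... | tri≈ _ a≡b _   | rightMinusPlus a<b _ _ = ⊥-elim (<-irrefl a≡b a<b)
... | tri> _ a≢b _   | stay a≡b _ = ⊥-elim (a≢b a≡b)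
... | tri> _ _ b<a   | rightPlusMinus a<b _ _ = ⊥-elim (<-asym a<b b<a)
... | tri> _ _ b<a   | rightMinusPlus a<b _ _ = ⊥-elim (<-asym a<b b<a)

step-rowwise : ∀ {ρ a b φ φ′} → Step ρ a b φ φ′ → (a ≡ b × ρ a ≡ true) ⊎ (a < b × (ρ a xor ρ b) ≡ true)
step-rowwise (stay a≡b ρa) = inj₁ (a≡b , ρa)
step-rowwise (rightPlusMinus a<b ρa ρb) rewrite ρa | ρb = inj₂ (a<b , refl)
step-rowwise (rightMinusPlus a<b ρa ρb) rewrite ρa | ρb = inj₂ (a<b , refl)

step-minusPlus-sets-flag : ∀ {ρ a b φ φ′} → Step ρ a b φ φ′ → (a <ᵇ b) ≡ true → (not (ρ a) ∧ ρ b) ≡ true → φ′ ≡ true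
step-minusPlus-sets-flag (stay a≡b _) a<b _ = ⊥-elim (<-irrefl a≡b (<ᵇ-true⁻ a<b))
step-minusPlus-sets-flag (rightPlusMinus _ ρa _) _ mp rewrite ρa = mp
step-minusPlus-sets-flag (rightMinusPlus _ _ _) _ _ = refl

step-keeps-flag : ∀ {ρ a b φ′} → Step ρ a b true φ′ → φ′ ≡ true
step-keeps-flag (stay _ _) = refl
step-keeps-flag (rightMinusPlus _ _ _) = refl

step-flagged-minusPlus : ∀ {ρ a b φ′} → Step ρ a b true φ′ → (a <ᵇ b) ≡ true → (not (ρ a) ∧ ρ b) ≡ true
step-flagged-minusPlus (stay a≡b _) a<b = ⊥-elim (<-irrefl a≡b (<ᵇ-true⁻ a<b))
step-flagged-minusPlus (rightMinusPlus _ ρa ρb) _ rewrite ρa | ρb = refl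

module Walks (d : ℕ) where

  patternOf : (rs : List Row) → SignPattern (length rs) d
  patternOf []       = V.[]
  patternOf (ρ ∷ rs) = V.tabulate (ρ ∘ toℕ) V.∷ patternOf rs

  walks : (rs : List Row) → Fin d → Bool → List (PathCode (length rs) d)
  walks []       c φ = [ c V.∷ V.[] ]
  walks (ρ ∷ rs) c φ = map (c V.∷_) (concatMap (λ c′ → maybe′ (walks rs c′) [] (step ρ (toℕ c) (toℕ c′) φ)) (allFin d))

  count : List Row → ℕ → Bool → ℕ
  count []       c φ = 1
  count (ρ ∷ rs) c φ = ∑< d λ c′ → maybe′ (count rs c′) 0 (step ρ c c′ φ)

  length-walks : ∀ rs c φ → length (walks rs c φ) ≡ count rs (toℕ c) φ
  length-walks []       c φ = refl
  length-walks (ρ ∷ rs) c φ = begin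
    length (map (c V.∷_) (concatMap next (allFin d))) ≡⟨ length-map _ (concatMap next (allFin d)) ⟩
    length (concatMap next (allFin d))                ≡⟨ length-concatMap next (allFin d) ⟩
    sum (map (length ∘ next) (allFin d))              ≡⟨ cong sum (map-cong length-next (allFin d)) ⟩
    sum (map (nextCount ∘ toℕ) (allFin d))            ≡⟨ cong sum (map-tabulate {n = d} id (nextCount ∘ toℕ)) ⟩
    sum (tabulate (nextCount ∘ toℕ {d}))              ≡⟨ ∑<-tabulate d nextCount ⟩
    count (ρ ∷ rs) (toℕ c) φ                          ∎
    where
    open ≡-Reasoning
    next : Fin d → List (PathCode (length rs) d)
    next c′ = maybe′ (walks rs c′) [] (step ρ (toℕ c) (toℕ c′) φ)
    nextCount : ℕ → ℕ
    nextCount c′ = maybe′ (count rs c′) 0 (step ρ (toℕ c) c′ φ)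
    length-next : ∀ c′ → length (next c′) ≡ nextCount (toℕ c′)
    length-next c′ with step ρ (toℕ c) (toℕ c′) φ
    ... | nothing = refl
    ... | just φ′ = length-walks rs c′ φ′

  walks⊆ : ∀ rs c φ → walks rs c φ ⊆ map (c V.∷_) (allVecs (allFin d) (length rs))
  walks⊆ []       c φ = ⊆-refl
  walks⊆ (ρ ∷ rs) c φ = map⁺ (c V.∷_) (concatMap⁺ (allFin d) next⊆)
    where
    next⊆ : ∀ c′ → maybe′ (walks rs c′) [] (step ρ (toℕ c) (toℕ c′) φ) ⊆ map (c′ V.∷_) (allVecs (allFin d) (length rs))
    next⊆ c′ with step ρ (toℕ c) (toℕ c′) φ
    ... | nothing = minimum _
    ... | just φ′ = walks⊆ rs c′ φ′

  record Admissible (rs : List Row) (φ : Bool) (v : PathCode (length rs) d) : Set where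
    field
      rowwise   : RowwiseAllowed (patternOf rs) v
      closed    : MinusPlusClosedBelow (patternOf rs) v
      flagged   : φ ≡ true → AllMinusPlus (patternOf rs) v

  admissible-∷ : ∀ {ρ rs φ φ′} c {w} → Step ρ (toℕ c) (toℕ (lookup w F.zero)) φ φ′ → Admissible rs φ′ w
               → Admissible (ρ ∷ rs) φ (c V.∷ w)
  admissible-∷ {ρ} {rs} {φ} {φ′} c {w} st adm = record { rowwise = rowwise′ ; closed = closed′ ; flagged = flagged′ }
    where
    open Admissible adm
    σ′ = patternOf (ρ ∷ rs)
    c′ = lookup w F.zero

    sign₀ : ∀ x → sign σ′ F.zero x ≡ ρ (toℕ x)
    sign₀ = lookup∘tabulate (ρ ∘ toℕ)

    rowwise′ : RowwiseAllowed σ′ (c V.∷ w)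
    rowwise′ F.zero rewrite sign₀ c | sign₀ c′ = step-rowwise st
    rowwise′ (F.suc i) = rowwise i

    minusPlus₀ : minusPlus σ′ (c V.∷ w) F.zero ≡ (not (ρ (toℕ c)) ∧ ρ (toℕ c′))
    minusPlus₀ = cong₂ (λ x y → not x ∧ y) (sign₀ c) (sign₀ c′)

    closed′ : MinusPlusClosedBelow σ′ (c V.∷ w)
    closed′ (F.suc i) (F.suc k) (s<s i<k) = closed i k i<k
    closed′ F.zero (F.suc k) _ h₀ hₖ mp₀ = flagged (step-minusPlus-sets-flag st h₀ (trans (sym minusPlus₀) mp₀)) k hₖ

    flagged′ : φ ≡ true → AllMinusPlus σ′ (c V.∷ w)
    flagged′ refl F.zero h₀ = trans minusPlus₀ (step-flagged-minusPlus st h₀)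
    flagged′ refl (F.suc k) = flagged (step-keeps-flag st) k

  AdmissibleFrom : (rs : List Row) → Fin d → Bool → PathCode (length rs) d → Set
  AdmissibleFrom rs c φ v = lookup v F.zero ≡ c × Admissible rs φ v

  walks-admissible : ∀ rs c φ → All (AdmissibleFrom rs c φ) (walks rs c φ)
  walks-admissible []       c φ = (refl , record { rowwise = λ () ; closed = λ () ; flagged = λ _ () }) ∷ []
  walks-admissible (ρ ∷ rs) c φ = All.map⁺ (All.concat⁺ (All.map⁺ (All.tabulate {xs = allFin d} λ {c′} _ → next c′)))
    where
    next : ∀ c′ → All (λ w → AdmissibleFrom (ρ ∷ rs) c φ (c V.∷ w)) (maybe′ (walks rs c′) [] (step ρ (toℕ c) (toℕ c′) φ))
    next c′ with step ρ (toℕ c) (toℕ c′) φ in eq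
    ... | nothing = []
    ... | just φ′ = All.map extend (walks-admissible rs c′ φ′)
      where
      extend : ∀ {w} → AdmissibleFrom rs c′ φ′ w → AdmissibleFrom (ρ ∷ rs) c φ (c V.∷ w)
      extend (refl , adm) = refl , admissible-∷ c (step-sound eq) adm

count≤Ntrop : ∀ {d} (rs : List Row) (c : Fin d) φ → Walks.count d rs (toℕ c) φ ≤ Ntrop (length rs) d
count≤Ntrop {d} rs c φ = begin
  count rs (toℕ c) φ         ≡⟨ length-walks rs c φ ⟨
  length (walks rs c φ)      ≤⟨ allowed-sublist≤numAllowed (patternOf rs) walks⊆allVecs allowed ⟩
  numAllowed (patternOf rs)  ≤⟨ numAllowed≤Ntrop (patternOf rs) ⟩
  Ntrop (length rs) d        ∎
  where
  open Walks d
  open ≤-Reasoning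
  walks⊆allVecs : walks rs c φ ⊆ allVecs (allFin d) (suc (length rs))
  walks⊆allVecs = ⊆-trans (walks⊆ rs c φ) (⊆-concatMap (∈-allFin c))
  allowed : All (λ v → tropicallyAllowed (patternOf rs) v ≡ true) (walks rs c φ)
  allowed = All.map (λ {v} (_ , adm) → rowwise⇒allowed (patternOf rs) v (Admissible.rowwise adm) (Admissible.closed adm))
                    (walks-admissible rs c φ)

hole : ℕ → Row
hole j c = not (c ≡ᵇ j)

hole-self : ∀ j → hole j j ≡ false
hole-self j rewrite ≡ᵇ-true (refl {x = j}) = refl

hole-other : ∀ {j c} → c ≢ j → hole j c ≡ true
hole-other c≢j rewrite ≡ᵇ-false c≢j = refl

staircase : ℕ → ℕ → List Row
staircase j zero    = []
staircase j (suc m) = hole j ∷ staircase (suc j) m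

length-staircase : ∀ j m → length (staircase j m) ≡ m
length-staircase j zero    = refl
length-staircase j (suc m) = cong suc (length-staircase (suc j) m)

staircase-plus : ∀ j m {c} → j + m ≤ c → All (λ ρ → ρ c ≡ true) (staircase j m)
staircase-plus j zero    _     = []
staircase-plus j (suc m) {c} j+m≤c = hole-other (>⇒≢ j<c) ∷ staircase-plus (suc j) m j+1+m≤c
  where
  j+1+m≤c = subst (_≤ c) (+-suc j m) j+m≤c
  j<c = ≤-trans (s≤s (m≤m+n j m)) j+1+m≤c

module Counting (d : ℕ) where
  open Walks d

  count-via : ∀ {ρ} rs {a b φ φ′} → Step ρ a b φ φ′ → maybe′ (count rs b) 0 (step ρ a b φ) ≡ count rs b φ′
  count-via rs st rewrite step-complete st = refl

  count-step : ∀ {ρ} rs {a b φ φ′} → Step ρ a b φ φ′ → b < d → count rs b φ′ ≤ count (ρ ∷ rs) a φ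
  count-step rs st b<d = ≤-trans (≤-reflexive (sym (count-via rs st))) (term≤∑< _ b<d)

  count-step₂ : ∀ {ρ} rs {a b₁ b₂ φ φ₁ φ₂} → Step ρ a b₁ φ φ₁ → Step ρ a b₂ φ φ₂ → b₁ < b₂ → b₂ < d
              → count rs b₁ φ₁ + count rs b₂ φ₂ ≤ count (ρ ∷ rs) a φ
  count-step₂ rs st₁ st₂ b₁<b₂ b₂<d =
    ≤-trans (≤-reflexive (sym (cong₂ _+_ (count-via rs st₁) (count-via rs st₂)))) (two≤∑< _ b₁<b₂ b₂<d)

  count-step₃ : ∀ {ρ} rs {a b₁ b₂ b₃ φ φ₁ φ₂ φ₃} → Step ρ a b₁ φ φ₁ → Step ρ a b₂ φ φ₂ → Step ρ a b₃ φ φ₃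
              → b₁ < b₂ → b₂ < b₃ → b₃ < d
              → count rs b₁ φ₁ + count rs b₂ φ₂ + count rs b₃ φ₃ ≤ count (ρ ∷ rs) a φ
  count-step₃ rs st₁ st₂ st₃ b₁<b₂ b₂<b₃ b₃<d =
    ≤-trans (≤-reflexive (sym (cong₂ _+_ (cong₂ _+_ (count-via rs st₁) (count-via rs st₂)) (count-via rs st₃))))
            (three≤∑< _ b₁<b₂ b₂<b₃ b₃<d)

  count-stay : ∀ {qs} rs {c φ} → All (λ ρ → ρ c ≡ true) qs → c < d → count rs c φ ≤ count (qs ++ rs) c φ
  count-stay rs []                  c<d = ≤-refl
  count-stay rs (_∷_ {xs = qs} ρc plus) c<d = ≤-trans (count-stay rs plus c<d) (count-step (qs ++ rs) (stay refl ρc) c<d)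

  1≤count : ∀ rs {c φ} → All (λ ρ → ρ c ≡ true) rs → c < d → 1 ≤ count rs c φ
  1≤count []       []          c<d = ≤-refl
  1≤count (_ ∷ rs) (ρc ∷ plus) c<d = ≤-trans (1≤count rs plus c<d) (count-step rs (stay refl ρc) c<d)

  flaggedStaircase : ℕ → ℕ → ℕ
  flaggedStaircase j m = ∑< m λ i → count (staircase j m) (j + i) true

  -- A flagged walk in the hole must move right, to any later column, while in every other column
  -- of the staircase it goes straight down: this doubles the count.  Each of the r hole-free
  -- columns right of the staircase carries at least one walk.
  flaggedStaircase-bound : ∀ j m r → j + m + r ≡ d → r * 2 ^ m ≤ flaggedStaircase j m + r
  flaggedStaircase-bound j zero    r _  = ≤-reflexive (*-identityʳ r)
  flaggedStaircase-bound j (suc m) r eq = begin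
    r * 2 ^ suc m            ≡⟨ double r (2 ^ m) ⟩
    r * 2 ^ m + r * 2 ^ m    ≤⟨ +-mono-≤ ih ih ⟩
    (Z + r) + (Z + r)        ≡⟨ regroup Z r ⟩
    (Z + r) + Z + r          ≤⟨ +-monoˡ-≤ r (+-mono-≤ fromHole besideHole) ⟩
    flaggedStaircase j (suc m) + r  ∎
    where
    open ≤-Reasoning
    S = staircase (suc j) m
    Z = flaggedStaircase (suc j) m
    ih = flaggedStaircase-bound (suc j) m r (trans (cong (_+ r) (sym (+-suc j m))) eq)
    double : ∀ x y → x * (2 * y) ≡ x * y + x * y
    double = solve-∀
    regroup : ∀ x y → (x + y) + (x + y) ≡ (x + y) + x + y
    regroup = solve-∀
    width : suc j + (m + r) ≡ d
    width = trans (cong suc (sym (+-assoc j m r))) (trans (cong (_+ r) (sym (+-suc j m))) eq)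
    inside : ∀ {i} → i < m + r → suc j + i < d
    inside i<m+r = subst (_ <_) width (+-monoʳ-< (suc j) i<m+r)
    j+1+i≢j : ∀ i → suc j + i ≢ j
    j+1+i≢j i = >⇒≢ (s≤s (m≤m+n j i))
    via : ℕ → ℕ
    via b = maybe′ (count S b) 0 (step (hole j) j b true)
    viaHole : ∀ i → via (suc j + i) ≡ count S (suc j + i) true
    viaHole i = count-via S (rightMinusPlus (s≤s (m≤m+n j i)) (hole-self j) (hole-other (j+1+i≢j i)))
    rightOfStaircase : ∀ i → i < r → 1 ≤ via (suc j + (m + i))
    rightOfStaircase i i<r = subst (1 ≤_) (sym (viaHole (m + i)))
      (1≤count S (staircase-plus (suc j) m (+-monoʳ-≤ (suc j) (m≤m+n m i))) (inside (+-monoʳ-< m i<r)))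
    fromHole : Z + r ≤ count (hole j ∷ S) (j + 0) true
    fromHole = begin
      Z + r                                                    ≡⟨ cong (_+ r) (∑<-cong m (sym ∘ viaHole)) ⟩
      ∑< m (via ∘ (suc j +_)) + r                              ≤⟨ +-monoʳ-≤ _ (n≤∑< r rightOfStaircase) ⟩
      ∑< m (via ∘ (suc j +_)) + ∑< r (via ∘ (suc j +_) ∘ (m +_)) ≡⟨ ∑<-split m r (via ∘ (suc j +_)) ⟨
      ∑< (m + r) (via ∘ (suc j +_))                            ≤⟨ suffix≤∑< (suc j) (m + r) via ⟩
      ∑< (suc j + (m + r)) via                                 ≡⟨ cong (λ n → ∑< n via) width ⟩
      count (hole j ∷ S) j true                                ≡⟨ cong (λ x → count (hole j ∷ S) x true) (+-identityʳ j) ⟨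
      count (hole j ∷ S) (j + 0) true                          ∎
    besideHole : Z ≤ ∑< m (λ i → count (hole j ∷ S) (j + suc i) true)
    besideHole = ∑<-mono m λ i i<m →
      subst (λ x → count S (suc j + i) true ≤ count (hole j ∷ S) x true) (sym (+-suc j i))
            (count-step S (stay refl (hole-other (j+1+i≢j i))) (inside (≤-trans i<m (m≤m+n m r))))

  -- An unflagged walk left of the hole either goes straight down or steps right into the hole.
  staircase-doubling : ∀ rs Q j m {a} → a < j → j + m ≤ d → (∀ {c} → j ≤ c → c < j + m → Q ≤ count rs c false)
                     → count rs a false + Q * 2 ^ m ≤ count (staircase j m ++ rs) a false + Q
  staircase-doubling rs Q j zero    {a} _ _ _ = ≤-reflexive (cong (count rs a false +_) (*-identityʳ Q))
  staircase-doubling rs Q j (suc m) {a} a<j j+m+1≤d large = +-cancelʳ-≤ Q _ _ (begin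
    X + Q * 2 ^ suc m + Q                  ≡⟨ split X Q (2 ^ m) ⟩
    (X + Q * 2 ^ m) + (Q + Q * 2 ^ m)      ≤⟨ +-mono-≤ fromLeft (+-monoˡ-≤ _ (large ≤-refl j<j+m+1)) ⟩
    (A₀ + Q) + (count rs j false + Q * 2 ^ m) ≤⟨ +-monoʳ-≤ (A₀ + Q) fromHole ⟩
    (A₀ + Q) + (A₁ + Q)                    ≡⟨ regroup A₀ A₁ Q ⟩
    A₀ + A₁ + Q + Q                        ≤⟨ +-monoˡ-≤ Q (+-monoˡ-≤ Q firstRow) ⟩
    count (staircase j (suc m) ++ rs) a false + Q + Q ∎)
    where
    open ≤-Reasoning
    rs′ = staircase (suc j) m ++ rs
    X  = count rs a false
    A₀ = count rs′ a false
    A₁ = count rs′ j false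
    split : ∀ x q y → x + q * (2 * y) + q ≡ (x + q * y) + (q + q * y)
    split = solve-∀
    regroup : ∀ x y q → (x + q) + (y + q) ≡ x + y + q + q
    regroup = solve-∀
    j<j+m+1 : j < j + suc m
    j<j+m+1 = ≤-trans (s≤s (m≤m+n j m)) (≤-reflexive (sym (+-suc j m)))
    j+1+m≤d : suc j + m ≤ d
    j+1+m≤d = subst (_≤ d) (+-suc j m) j+m+1≤d
    large′ : ∀ {c} → suc j ≤ c → c < suc j + m → Q ≤ count rs c false
    large′ {c} j<c c<j+1+m = large (<⇒≤ j<c) (subst (c <_) (sym (+-suc j m)) c<j+1+m)
    fromLeft = staircase-doubling rs Q (suc j) m (≤-trans a<j (n≤1+n j)) j+1+m≤d large′
    fromHole = staircase-doubling rs Q (suc j) m ≤-refl j+1+m≤d large′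
    a≢j = <⇒≢ a<j
    firstRow : A₀ + A₁ ≤ count (hole j ∷ rs′) a false
    firstRow = count-step₂ rs′ (stay refl (hole-other a≢j)) (rightPlusMinus a<j (hole-other a≢j) (hole-self j))
                           a<j (≤-trans j<j+m+1 j+m+1≤d)

m*0≤n : ∀ m n → m * 0 ≤ n
m*0≤n m n = subst (_≤ n) (sym (*-zeroʳ m)) z≤n

-- The pattern

module Construction (e : ℕ) where

  d c₂ c₃ : ℕ
  d  = 4 + e
  c₂ = 2 + e
  c₃ = 3 + e

  open Walks d
  open Counting d

  middle : Row
  middle c = not (c ≡ᵇ 1) ∧ not (c ≡ᵇ c₂)

  middle-0 : middle 0 ≡ true
  middle-0 = refl

  middle-1 : middle 1 ≡ false
  middle-1 = refl

  middle-c₂ : middle c₂ ≡ false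
  middle-c₂ rewrite ≡ᵇ-true (refl {x = c₂}) = refl

  middle-plus : ∀ {c} → c ≢ 1 → c ≢ c₂ → middle c ≡ true
  middle-plus c≢1 c≢c₂ rewrite ≡ᵇ-false c≢1 | ≡ᵇ-false c≢c₂ = refl

  middle-c₃ : middle c₃ ≡ true
  middle-c₃ = middle-plus (λ ()) (>⇒≢ (n<1+n c₂))

  middleBlock : ℕ → List Row
  middleBlock m = replicate m middle ++ staircase 2 e

  tropicalPattern : ℕ → List Row
  tropicalPattern B = staircase 1 (suc e) ++ middleBlock B

  length-tropicalPattern : ∀ B → length (tropicalPattern B) ≡ suc e + (B + e)
  length-tropicalPattern B = begin
    length (tropicalPattern B)                            ≡⟨ length-++ (staircase 1 (suc e)) ⟩
    length (staircase 1 (suc e)) + length (middleBlock B) ≡⟨ cong₂ _+_ (length-staircase 1 (suc e)) lengthMiddle ⟩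
    suc e + (B + e)                                       ∎
    where
    open ≡-Reasoning
    lengthMiddle : length (middleBlock B) ≡ B + e
    lengthMiddle = trans (length-++ (replicate B _)) (cong₂ _+_ (length-replicate B) (length-staircase 2 e))

  column-c₃-plus : ∀ m → All (λ ρ → ρ c₃ ≡ true) (middleBlock m)
  column-c₃-plus m = All.++⁺ (All.replicate⁺ m middle-c₃) (staircase-plus 2 e (n≤1+n c₂))

  1≤count-c₂ : ∀ m φ → 1 ≤ count (middleBlock m) c₂ φ
  1≤count-c₂ zero    φ = 1≤count (staircase 2 e) (staircase-plus 2 e ≤-refl) (n≤1+n _)
  1≤count-c₂ (suc m) φ = ≤-trans (1≤count (middleBlock m) (column-c₃-plus m) ≤-refl)
                                 (count-step (middleBlock m) (rightMinusPlus ≤-refl middle-c₂ middle-c₃) ≤-refl)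

  -- A walk leaving column 1, a '−' of the middle row, must move right and becomes flagged.
  count-from-1 : ∀ m φ → 2 ^ suc e ≤ count (middleBlock (suc m)) 1 φ + 1
  count-from-1 m φ = begin
    2 ^ suc e                            ≤⟨ flaggedStaircase-bound 2 e 2 (+-comm c₂ 2) ⟩
    flaggedStaircase 2 e + 2             ≡⟨ +-assoc (flaggedStaircase 2 e) 1 1 ⟨
    flaggedStaircase 2 e + 1 + 1         ≤⟨ +-monoˡ-≤ 1 (+-mono-≤ stairs rightmost) ⟩
    ∑< e (via ∘ (2 +_)) + via c₃ + 1     ≤⟨ +-monoˡ-≤ 1 (prefix+term≤∑< (via ∘ (2 +_)) (n≤1+n e) ≤-refl) ⟩
    ∑< (2 + e) (via ∘ (2 +_)) + 1        ≤⟨ +-monoˡ-≤ 1 (suffix≤∑< 2 (2 + e) via) ⟩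
    count (middleBlock (suc m)) 1 φ + 1  ∎
    where
    open ≤-Reasoning
    via : ℕ → ℕ
    via b = maybe′ (count (middleBlock m) b) 0 (step middle 1 b φ)
    viaStep : ∀ {b φ′} → Step middle 1 b φ φ′ → via b ≡ count (middleBlock m) b φ′
    viaStep = count-via (middleBlock m)
    stairs : flaggedStaircase 2 e ≤ ∑< e (via ∘ (2 +_))
    stairs = ∑<-mono e λ i i<e →
      let plus = middle-plus (λ ()) (<⇒≢ (+-monoʳ-< 2 i<e)) in
      ≤-trans (count-stay (staircase 2 e) (All.replicate⁺ m plus) (≤-trans (+-monoʳ-< 2 i<e) (m≤n+m c₂ 2)))
              (≤-reflexive (sym (viaStep (rightMinusPlus (s≤s (s≤s z≤n)) middle-1 plus))))
    rightmost : 1 ≤ via c₃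
    rightmost = ≤-trans (1≤count (middleBlock m) (column-c₃-plus m) ≤-refl)
                        (≤-reflexive (sym (viaStep (rightMinusPlus (s≤s (s≤s z≤n)) middle-1 middle-c₃))))

  c₂<d : c₂ < d
  c₂<d = n≤1+n _

  m≤count : ∀ m {a} → a < c₂ → middle a ≡ true → m ≤ count (middleBlock m) a false
  m≤count zero    _    _    = z≤n
  m≤count (suc m) {a} a<c₂ plus = begin
    suc m                                                          ≡⟨ +-comm 1 m ⟩
    m + 1                                                          ≤⟨ +-mono-≤ (m≤count m a<c₂ plus) (1≤count-c₂ m false) ⟩
    count (middleBlock m) a false + count (middleBlock m) c₂ false ≤⟨ firstRow ⟩
    count (middleBlock (suc m)) a false                            ∎
    where
    open ≤-Reasoning
    firstRow = count-step₂ (middleBlock m) (stay refl plus) (rightPlusMinus a<c₂ plus middle-c₂) a<c₂ c₂<d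

  exits-from-0 : ∀ m → count (middleBlock m) 0 false + count (middleBlock m) 1 false + count (middleBlock m) c₂ false
                 ≤ count (middleBlock (suc m)) 0 false
  exits-from-0 m =
    count-step₃ {middle} (middleBlock m) (stay refl middle-0) (rightPlusMinus z<s middle-0 middle-1)
                (rightPlusMinus z<s middle-0 middle-c₂) (s≤s z≤n) (s≤s (s≤s z≤n)) c₂<d

  count-from-0 : ∀ m → 1 + m * 2 ^ suc e ≤ count (middleBlock (suc m)) 0 false
  count-from-0 zero    = ≤-trans (1≤count-c₂ 0 false) (≤-trans (m≤n+m _ _) (exits-from-0 0))
  count-from-0 (suc m) = begin
    1 + (P + m * P)          ≡⟨ shuffle m P ⟩
    (1 + m * P) + P          ≤⟨ +-mono-≤ (count-from-0 m) (count-from-1 m false) ⟩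
    X₀ + (X₁ + 1)            ≡⟨ +-assoc X₀ X₁ 1 ⟨
    X₀ + X₁ + 1              ≤⟨ +-monoʳ-≤ (X₀ + X₁) (1≤count-c₂ (suc m) false) ⟩
    X₀ + X₁ + X₂             ≤⟨ exits-from-0 (suc m) ⟩
    count (middleBlock (suc (suc m))) 0 false ∎
    where
    open ≤-Reasoning
    P  = 2 ^ suc e
    X₀ = count (middleBlock (suc m)) 0 false
    X₁ = count (middleBlock (suc m)) 1 false
    X₂ = count (middleBlock (suc m)) c₂ false
    shuffle : ∀ m P → 1 + (P + m * P) ≡ (1 + m * P) + P
    shuffle = solve-∀

  count-tropicalPattern-+ : ∀ m → let B = suc m in B * 2 ^ c₂ ≤ count (tropicalPattern B) 0 false + (B + B)
  count-tropicalPattern-+ m = +-cancelʳ-≤ 1 _ _ (begin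
    B * (2 * P) + 1                               ≡⟨ expand m (2 ^ e) ⟩
    (1 + m * P) + P + B * 2 ^ e + B * 2 ^ e       ≤⟨ +-monoˡ-≤ _ (+-monoˡ-≤ _ (+-mono-≤ (count-from-0 m) (count-from-1 m false))) ⟩
    X₀ + (X₁ + 1) + B * 2 ^ e + B * 2 ^ e         ≡⟨ regroup X₀ X₁ (B * 2 ^ e) ⟩
    (X₀ + B * 2 ^ e) + (X₁ + B * 2 ^ e) + 1       ≤⟨ +-monoˡ-≤ 1 (+-mono-≤ (doubling z<s) (doubling (s≤s (s≤s z≤n)))) ⟩
    (A₀ + B) + (A₁ + B) + 1                       ≡⟨ interchange A₀ A₁ B ⟩
    A₀ + A₁ + (B + B) + 1                         ≤⟨ +-monoˡ-≤ 1 (+-monoˡ-≤ (B + B) firstRow) ⟩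
    count (tropicalPattern B) 0 false + (B + B) + 1 ∎)
    where
    open ≤-Reasoning
    B = suc m
    P = 2 ^ suc e
    rs = staircase 2 e ++ middleBlock B
    X₀ = count (middleBlock B) 0 false
    X₁ = count (middleBlock B) 1 false
    A₀ = count rs 0 false
    A₁ = count rs 1 false
    expand : ∀ m x → suc m * (2 * (2 * x)) + 1 ≡ (1 + m * (2 * x)) + 2 * x + suc m * x + suc m * x
    expand = solve-∀
    regroup : ∀ x y z → x + (y + 1) + z + z ≡ (x + z) + (y + z) + 1
    regroup = solve-∀
    interchange : ∀ x y z → (x + z) + (y + z) + 1 ≡ x + y + (z + z) + 1
    interchange = solve-∀
    large : ∀ {c} → 2 ≤ c → c < 2 + e → B ≤ count (middleBlock B) c false
    large 2≤c c<c₂ = m≤count B c<c₂ (middle-plus (>⇒≢ 2≤c) (<⇒≢ c<c₂))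
    doubling : ∀ {a} → a < 2 → count (middleBlock B) a false + B * 2 ^ e ≤ count rs a false + B
    doubling a<2 = staircase-doubling (middleBlock B) B 2 e a<2 (m≤n+m c₂ 2) large
    firstRow : A₀ + A₁ ≤ count (tropicalPattern B) 0 false
    firstRow = count-step₂ {hole 1} rs (stay refl refl) (rightPlusMinus z<s refl (hole-self 1)) z<s (s≤s (s≤s z≤n))

  count-tropicalPattern : ∀ B → B * (2 ^ c₂ ∸ 2) ≤ count (tropicalPattern B) 0 false
  count-tropicalPattern zero    = z≤n
  count-tropicalPattern (suc m) = +-cancelʳ-≤ (B + B) _ _ (begin
    B * (2 ^ c₂ ∸ 2) + (B + B)       ≡⟨ cong (B * (2 ^ c₂ ∸ 2) +_) (double B) ⟩
    B * (2 ^ c₂ ∸ 2) + B * 2         ≡⟨ *-distribˡ-+ B (2 ^ c₂ ∸ 2) 2 ⟨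
    B * (2 ^ c₂ ∸ 2 + 2)             ≡⟨ cong (B *_) (m∸n+n≡m 2≤2^c₂) ⟩
    B * 2 ^ c₂                       ≤⟨ count-tropicalPattern-+ m ⟩
    count (tropicalPattern B) 0 false + (B + B) ∎)
    where
    open ≤-Reasoning
    B = suc m
    double : ∀ x → x + x ≡ x * 2
    double = solve-∀
    2≤2^c₂ : 2 ≤ 2 ^ c₂
    2≤2^c₂ = *-monoʳ-≤ 2 (m^n>0 2 (suc e))

proposition18 : (p d : ℕ) → 2 * d ≤ p →
    (p ∸ 2 * d + 7) * (2 ^ (d ∸ 2) ∸ 2) ≤ Ntrop p d
proposition18 p 0 _ = m*0≤n (p + 7) _
proposition18 p 1 _ = m*0≤n (p ∸ 2 + 7) _
proposition18 p 2 _ = m*0≤n (p ∸ 4 + 7) _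
proposition18 p 3 _ = m*0≤n (p ∸ 6 + 7) _
proposition18 p d@(suc (suc (suc (suc e)))) 2d≤p = begin
  B * (2 ^ c₂ ∸ 2)                      ≤⟨ count-tropicalPattern B ⟩
  count (tropicalPattern B) 0 false     ≤⟨ count≤Ntrop (tropicalPattern B) F.zero false ⟩
  Ntrop (length (tropicalPattern B)) d  ≡⟨ cong (λ n → Ntrop n d) height ⟩
  Ntrop p d                             ∎
  where
  open Construction e using (c₂; tropicalPattern; length-tropicalPattern; count-tropicalPattern)
  open Walks d using (count)
  open ≤-Reasoning
  B = p ∸ 2 * d + 7
  sizes : ∀ q e → suc e + ((q + 7) + e) ≡ q + 2 * (4 + e)
  sizes = solve-∀
  height : length (tropicalPattern B) ≡ p
  height = trans (length-tropicalPattern B) (trans (sizes (p ∸ 2 * d) e) (m∸n+n≡m 2d≤p))
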